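{- Let $r\ge 3$ and $k=2r-1$. There exists a constant $c>0$ such that for all sufficiently large $n$, $$\mathrm{ex}_k(n,Q_k(r))\ \ge\ c\, r_r(n)\, n^{k-2}.$$
   Context: A $k$-uniform hypergraph ($k$-graph) is a pair $(V,E)$ with $E$ a collection of $k$-element subsets of $V$. For a $k$-graph $F$, $\mathrm{ex}_k(n,F)$ denotes the maximum number of edges in an $n$-vertex $k$-graph containing no subhypergraph isomorphic to $F$. For integers $k\ge r\ge 2$, let $A=\{a_1,\dots,a_{k-r}\}$, $B=\{b_1,\dots,b_r\}$, $C=\{c_1,\dots,c_r\}$ be pairwise disjoint sets; $Q_k(r)$ is the $k$-graph on $A\cup B\cup C$ whose edges are the $r$ sets $A\cup(B\setminus\{b_i\})\cup\{c_i\}$, $1\le i\le r$. For integers $m,n\ge1$, $r_m(n)$ denotes the maximum size of a set $A\subseteq\{1,\dots,n\}$ containing no $m$ distinct elements forming an arithmetic progression of length $m$. -}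

module Defs where

open import Data.Nat using (ℕ; _+_; _*_; _∸_; _≤_; _<_)
open import Data.Fin using (Fin; _≟_)
open import Data.Fin.Subset using (Subset; ⁅_⁆; ⋃; ∣_∣)
open import Data.List using (List; []; _∷_; map; length; _++_; filter; allFin)
open import Data.List.Membership.Propositional using (_∈_)
open import Data.List.Relation.Unary.All using (All)
open import Data.List.Relation.Unary.Unique.Propositional using (Unique)
open import Data.Product using (Σ; ∃; ∃-syntax; _×_)
open import Data.Sum using (_⊎_; inj₁; inj₂)
open import Function using (_∘_)
open import Function.Definitions using (Injective)
open import Relation.Binary.PropositionalEquality using (_≡_)
open import Relation.Nullary using (¬_; ¬?)

record KGraph (k n : ℕ) : Set where
  field
    edges   : List (Subset n)
    unique  : Unique edges
    uniform : All (λ e → ∣ e ∣ ≡ k) edges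
open KGraph public

∣E∣ : ∀ {k n} → KGraph k n → ℕ
∣E∣ H = length (edges H)

record Pattern : Set₁ where
  field
    Vtx   : Set
    pedges : List (List Vtx)
open Pattern public

image : ∀ {V : Set} {n} → (V → Fin n) → List V → Subset n
image φ e = ⋃ (map (⁅_⁆ ∘ φ) e)

Contains : ∀ {k n} → KGraph k n → Pattern → Set
Contains {n = n} H F =
  Σ (Vtx F → Fin n) λ φ → Injective _≡_ _≡_ φ × All (λ e → image φ e ∈ edges H) (pedges F)

IsEx : ℕ → ℕ → Pattern → ℕ → Set
IsEx k n F m =
  (∃[ H ] (¬ Contains {k} {n} H F × ∣E∣ H ≡ m))
  × (∀ (H : KGraph k n) → ¬ Contains H F → ∣E∣ H ≤ m)

-- Q_k(r): vertices A = Fin (k ∸ r) (inj₁), B = Fin r (inj₂ ∘ inj₁),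
-- C = Fin r (inj₂ ∘ inj₂); edges A ∪ (B ∖ {b_i}) ∪ {c_i}, i ∈ Fin r.
Q : ℕ → ℕ → Pattern
Q k r = record
  { Vtx = Fin (k ∸ r) ⊎ (Fin r ⊎ Fin r)
  ; pedges = map edge (allFin r)
  }
  where
  edge : Fin r → List (Fin (k ∸ r) ⊎ (Fin r ⊎ Fin r))
  edge i = map inj₁ (allFin (k ∸ r))
        ++ map (inj₂ ∘ inj₁) (filter (λ j → ¬? (j ≟ i)) (allFin r))
        ++ (inj₂ (inj₂ i) ∷ [])

SubsetUpTo : ℕ → List ℕ → Set
SubsetUpTo n A = Unique A × All (λ x → 1 ≤ x × x ≤ n) A

HasAP : ℕ → List ℕ → Set
HasAP m A = ∃[ a ] ∃[ d ] (1 ≤ d × (∀ j → j < m → a + j * d ∈ A))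

IsRAP : ℕ → ℕ → ℕ → Set
IsRAP m n s =
  (∃[ A ] (SubsetUpTo n A × ¬ HasAP m A × length A ≡ s))
  × (∀ A → SubsetUpTo n A → ¬ HasAP m A → length A ≤ s)

-- Split the vertices into k = 2r − 1 parts of P labels and take as edges the
-- transversals of tuples t ∈ ℕᵏ whose first d = k − 2 coordinates range over
-- [0, m)ᵈ and whose last two are fixed by those and by an element a of an
-- r-AP-free set B in a window of length m, so that the linear form `weight`
-- vanishes on t and the form `moment` equals a (up to the shift of the window).
-- This gives mᵈ·|B| edges.  The r edges of a copy of Q_k(r) are tuples t₁ … t_r
-- that pairwise agree except at distinct positions π₁ … π_r, where t_i alone
-- leaves the common value.  As `weight` vanishes on the first r − 1 positions,
-- balancing pushes every π_i into the last r positions; then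
-- moment(t_i) = C + T·(π_i − (r − 1)) with T ≠ 0, so the a_i form an r-term
-- progression in B.  Finally, pigeonholing an extremal AP-free subset of [1, n]
-- over windows of length m ≈ n / N puts a constant fraction of it into one window.
module Submission where

open import Data.Bool using (Bool; true; false; if_then_else_)
open import Data.Empty using (⊥-elim)
open import Data.Fin as F using (Fin; toℕ; fromℕ<; punchOut)
open import Data.Fin.Properties
  using (toℕ-fromℕ<; toℕ-injective; fromℕ<-injective; any?; injective⇒≤; <⇒notInjective; punchOut-injective)
open import Data.Fin.Subset using (Subset; ⁅_⁆; ∣_∣) renaming (_∈_ to _∈ₛ_)
open import Data.Fin.Subset.Properties using (x∈p∪q⁻; x∈p∪q⁺; x∈⁅y⁆⇒x≡y; x∈⁅x⁆; ∉⊥)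
open import Data.Integer as ℤ using (ℤ; +_; -_; -[1+_]; 0ℤ; 1ℤ; -1ℤ)
import Data.Integer.Properties as ℤ
import Data.Integer.Solver as ℤ-Solver
open import Data.List
  using (List; []; _∷_; map; _++_; length; filter; allFin; upTo; cartesianProductWith; cartesianProduct)
open import Data.List.Properties using (length-++; length-map; length-upTo; ∷-injective)
open import Data.List.Membership.Propositional using (_∈_)
open import Data.List.Membership.Propositional.Properties
  using ( ∈-++⁺ˡ; ∈-++⁺ʳ; ∈-++⁻; ∈-map⁺; ∈-map⁻; ∈-filter⁺; ∈-filter⁻; ∈-allFin; ∈-upTo⁻
        ; ∈-cartesianProductWith⁻; ∈-cartesianProduct⁻)
open import Data.List.Relation.Unary.All as All using (All; []; _∷_)
import Data.List.Relation.Unary.All.Properties as All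
open import Data.List.Relation.Unary.Any using (here; there)
open import Data.List.Relation.Unary.Unique.Propositional using (Unique; []; _∷_)
open import Data.List.Relation.Unary.Unique.Propositional.Properties
  using (cartesianProductWith⁺; cartesianProduct⁺; upTo⁺; filter⁺)
open import Data.Nat
  using (ℕ; zero; suc; _+_; _*_; _∸_; _^_; _<_; _≤_; z≤n; s≤s; NonZero; _/_; _%_; _≟_; _<?_; _≤?_)
open import Data.Nat.DivMod
  using ( m≡m%n+[m/n]*n; m%n<n; m/n*n≤m; m≥n⇒m/n>0; m<n*o⇒m/o<n; m*n/n≡m; m<n⇒m/n≡0; m<n⇒m%n≡m
        ; +-distrib-/-∣ˡ; [m+kn]%n≡m%n; /-monoˡ-≤)
open import Data.Nat.Divisibility using (divides-refl)
open import Data.Nat.Properties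
import Data.Nat.Solver as ℕ-Solver
open import Data.Product using (∃-syntax; _×_; _,_; proj₁; proj₂)
open import Data.Sum using (_⊎_; inj₁; inj₂)
open import Data.Unit using (⊤; tt)
open import Data.Vec using (tabulate; _∷_)
open import Data.Vec.Properties using (lookup∘tabulate; []=⇒lookup; lookup⇒[]=)
open import Function using (_∘_; _∘′_; case_of_)
open import Function.Definitions using (Injective)
open import Relation.Binary.PropositionalEquality
open import Relation.Nullary using (¬_; Dec; yes; no; does; proof; ¬?; contradiction)
open import Relation.Nullary.Decidable using (_×-dec_; dec-true; dec-false)
open import Relation.Nullary.Reflects using (Reflects; invert)
open import Defs

sumℕ : ℕ → (ℕ → ℕ) → ℕ
sumℕ zero    f = 0
sumℕ (suc n) f = sumℕ n f + f n

sumℤ : ℕ → (ℕ → ℤ) → ℤ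
sumℤ zero    f = 0ℤ
sumℤ (suc n) f = sumℤ n f ℤ.+ f n

sumℕ-cong : ∀ n {f g} → (∀ x → x < n → f x ≡ g x) → sumℕ n f ≡ sumℕ n g
sumℕ-cong zero    f≡g = refl
sumℕ-cong (suc n) f≡g = cong₂ _+_ (sumℕ-cong n λ x x<n → f≡g x (m<n⇒m<1+n x<n)) (f≡g n ≤-refl)

sumℤ-cong : ∀ n {f g} → (∀ x → x < n → f x ≡ g x) → sumℤ n f ≡ sumℤ n g
sumℤ-cong zero    f≡g = refl
sumℤ-cong (suc n) f≡g = cong₂ ℤ._+_ (sumℤ-cong n λ x x<n → f≡g x (m<n⇒m<1+n x<n)) (f≡g n ≤-refl)

sumℕ-zero : ∀ n {f} → (∀ x → x < n → f x ≡ 0) → sumℕ n f ≡ 0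
sumℕ-zero zero    f≡0 = refl
sumℕ-zero (suc n) f≡0 = cong₂ _+_ (sumℕ-zero n λ x x<n → f≡0 x (m<n⇒m<1+n x<n)) (f≡0 n ≤-refl)

sumℤ-zero : ∀ n {f} → (∀ x → x < n → f x ≡ 0ℤ) → sumℤ n f ≡ 0ℤ
sumℤ-zero zero    f≡0 = refl
sumℤ-zero (suc n) f≡0 = cong₂ ℤ._+_ (sumℤ-zero n λ x x<n → f≡0 x (m<n⇒m<1+n x<n)) (f≡0 n ≤-refl)

sumℕ-+ : ∀ a b f → sumℕ (a + b) f ≡ sumℕ a f + sumℕ b (λ y → f (a + y))
sumℕ-+ a zero    f = trans (cong (λ c → sumℕ c f) (+-identityʳ a)) (sym (+-identityʳ _))
sumℕ-+ a (suc b) f rewrite +-suc a b | sumℕ-+ a b f = +-assoc (sumℕ a f) _ _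

sumℤ-+ : ∀ a b f → sumℤ (a + b) f ≡ sumℤ a f ℤ.+ sumℤ b (λ y → f (a + y))
sumℤ-+ a zero    f = trans (cong (λ c → sumℤ c f) (+-identityʳ a)) (sym (ℤ.+-identityʳ _))
sumℤ-+ a (suc b) f rewrite +-suc a b | sumℤ-+ a b f = ℤ.+-assoc (sumℤ a f) _ _

sumℕ-suc : ∀ n f → sumℕ (suc n) f ≡ f 0 + sumℕ n (λ x → f (suc x))
sumℕ-suc n f = trans (sumℕ-+ 1 n f) (cong (_+ sumℕ n (λ x → f (suc x))) (+-identityˡ (f 0)))

sumℕ-distrib-+ : ∀ n f g → sumℕ n (λ x → f x + g x) ≡ sumℕ n f + sumℕ n g
sumℕ-distrib-+ zero    f g = refl
sumℕ-distrib-+ (suc n) f g rewrite sumℕ-distrib-+ n f g =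
  solve 4 (λ a b c d → (a :+ b) :+ (c :+ d) := (a :+ c) :+ (b :+ d)) refl (sumℕ n f) (sumℕ n g) (f n) (g n)
  where open ℕ-Solver.+-*-Solver

sumℤ-distrib-- : ∀ n f g → sumℤ n (λ x → f x ℤ.- g x) ≡ sumℤ n f ℤ.- sumℤ n g
sumℤ-distrib-- zero    f g = refl
sumℤ-distrib-- (suc n) f g rewrite sumℤ-distrib-- n f g =
  solve 4 (λ a b c d → (a :- b) :+ (c :- d) := (a :+ c) :- (b :+ d)) refl (sumℤ n f) (sumℤ n g) (f n) (g n)
  where open ℤ-Solver.+-*-Solver

sumℕ-* : ∀ k P f → sumℕ (k * P) f ≡ sumℕ k (λ j → sumℕ P (λ x → f (j * P + x)))
sumℕ-* zero    P f = refl
sumℕ-* (suc k) P f = begin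
  sumℕ (P + k * P) f                                    ≡⟨ cong (λ c → sumℕ c f) (+-comm P (k * P)) ⟩
  sumℕ (k * P + P) f                                    ≡⟨ sumℕ-+ (k * P) P f ⟩
  sumℕ (k * P) f + sumℕ P (λ x → f (k * P + x))         ≡⟨ cong (_+ sumℕ P (λ x → f (k * P + x))) (sumℕ-* k P f) ⟩
  sumℕ k (λ j → sumℕ P (λ x → f (j * P + x))) + sumℕ P (λ x → f (k * P + x)) ∎
  where open ≡-Reasoning

sumℕ-const : ∀ n c → sumℕ n (λ _ → c) ≡ n * c
sumℕ-const zero    c = refl
sumℕ-const (suc n) c = trans (cong (_+ c) (sumℕ-const n c)) (+-comm (n * c) c)

sumℕ-≤ : ∀ n f B → (∀ x → x < n → f x ≤ B) → sumℕ n f ≤ n * B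
sumℕ-≤ zero    f B f≤B = z≤n
sumℕ-≤ (suc n) f B f≤B = ≤-trans
  (+-mono-≤ (sumℕ-≤ n f B λ x x<n → f≤B x (m<n⇒m<1+n x<n)) (f≤B n ≤-refl))
  (≤-reflexive (+-comm (n * B) B))

sumℤ-pos : ∀ n f → sumℤ n (λ x → + f x) ≡ + sumℕ n f
sumℤ-pos zero    f = refl
sumℤ-pos (suc n) f rewrite sumℤ-pos n f = sym (ℤ.pos-+ (sumℕ n f) (f n))

sumℤ-neg : ∀ n f → sumℤ n (λ x → - f x) ≡ - sumℤ n f
sumℤ-neg zero    f = refl
sumℤ-neg (suc n) f rewrite sumℤ-neg n f = sym (ℤ.neg-distrib-+ (sumℤ n f) (f n))

sumℤ-single : ∀ n f p → p < n → (∀ x → x < n → x ≢ p → f x ≡ 0ℤ) → sumℤ n f ≡ f p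
sumℤ-single (suc n) f p p<1+n f≡0 with n ≟ p
... | yes refl = trans (cong (ℤ._+ f n) (sumℤ-zero n λ x x<n → f≡0 x (m<n⇒m<1+n x<n) (<⇒≢ x<n)))
                       (ℤ.+-identityˡ (f n))
... | no n≢p = begin
  sumℤ n f ℤ.+ f n ≡⟨ cong₂ ℤ._+_ (sumℤ-single n f p p<n λ x x<n → f≡0 x (m<n⇒m<1+n x<n))
                                   (f≡0 n ≤-refl n≢p) ⟩
  f p ℤ.+ 0ℤ       ≡⟨ ℤ.+-identityʳ (f p) ⟩
  f p              ∎
  where
  open ≡-Reasoning
  p<n : p < n
  p<n = ≤∧≢⇒< (≤-pred p<1+n) (≢-sym n≢p)

sumℤ-pair : ∀ n f p q → p < n → q < n → p ≢ q →
            (∀ x → x < n → x ≢ p → x ≢ q → f x ≡ 0ℤ) → sumℤ n f ≡ f p ℤ.+ f q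
sumℤ-pair (suc n) f p q p<1+n q<1+n p≢q f≡0 with n ≟ p | n ≟ q
... | yes refl | _ = trans
  (cong (ℤ._+ f n) (sumℤ-single n f q (≤∧≢⇒< (≤-pred q<1+n) (≢-sym p≢q))
                     λ x x<n → f≡0 x (m<n⇒m<1+n x<n) (<⇒≢ x<n)))
  (ℤ.+-comm (f q) (f n))
... | no _ | yes refl = cong (ℤ._+ f n) (sumℤ-single n f p (≤∧≢⇒< (≤-pred p<1+n) p≢q)
                          λ x x<n x≢p → f≡0 x (m<n⇒m<1+n x<n) x≢p (<⇒≢ x<n))
... | no n≢p | no n≢q = trans
  (cong₂ ℤ._+_ (sumℤ-pair n f p q (≤∧≢⇒< (≤-pred p<1+n) (≢-sym n≢p)) (≤∧≢⇒< (≤-pred q<1+n) (≢-sym n≢q)) p≢q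
                  λ x x<n → f≡0 x (m<n⇒m<1+n x<n))
               (f≡0 n ≤-refl n≢p n≢q))
  (ℤ.+-identityʳ _)

indicator : Bool → ℕ
indicator b = if b then 1 else 0

sumℕ-indicator-≡ : ∀ n c → c < n → sumℕ n (λ x → indicator (does (x ≟ c))) ≡ 1
sumℕ-indicator-≡ (suc n) c c<1+n with n ≟ c
... | yes refl = cong₂ _+_ (sumℕ-zero n λ x x<n → cong indicator (dec-false (x ≟ n) (<⇒≢ x<n)))
                          (cong indicator (dec-true (n ≟ n) refl))
... | no n≢c = cong₂ _+_ (sumℕ-indicator-≡ n c (≤∧≢⇒< (≤-pred c<1+n) (≢-sym n≢c)))
                        (cong indicator (dec-false (n ≟ c) n≢c))

∣tabulate∣ : ∀ n (g : ℕ → Bool) → ∣ tabulate {n = n} (λ w → g (toℕ w)) ∣ ≡ sumℕ n (λ x → indicator (g x))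
∣tabulate∣ zero    g = refl
∣tabulate∣ (suc n) g = begin
  ∣ g 0 ∷ tabulate {n = n} (λ w → g (suc (toℕ w))) ∣
    ≡⟨ ∣∷∣ (g 0) (tabulate {n = n} (λ w → g (suc (toℕ w)))) ⟩
  indicator (g 0) + ∣ tabulate {n = n} (λ w → g (suc (toℕ w))) ∣
    ≡⟨ cong (_+_ (indicator (g 0))) (∣tabulate∣ n (λ x → g (suc x))) ⟩
  indicator (g 0) + sumℕ n (λ x → indicator (g (suc x)))
    ≡⟨ sumℕ-suc n (λ x → indicator (g x)) ⟨
  sumℕ (suc n) (λ x → indicator (g x)) ∎
  where
  open ≡-Reasoning
  ∣∷∣ : ∀ {m} b (p : Subset m) → ∣ b ∷ p ∣ ≡ indicator b + ∣ p ∣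
  ∣∷∣ true  p = refl
  ∣∷∣ false p = refl

sumℕ-≤-max : ∀ K F → 0 < K → ∃[ b ] sumℕ K F ≤ K * F b
sumℕ-≤-max (suc zero) F _ = 0 , ≤-reflexive (sym (+-identityʳ (F 0)))
sumℕ-≤-max (suc (suc K)) F _ with sumℕ-≤-max (suc K) F (s≤s z≤n)
... | b , Σ≤ with F b ≤? F (suc K)
...   | yes Fb≤ = suc K , ≤-trans (+-monoˡ-≤ (F (suc K)) (≤-trans Σ≤ (*-monoʳ-≤ (suc K) Fb≤)))
                                  (≤-reflexive (+-comm (suc K * F (suc K)) (F (suc K))))
...   | no Fb≰ = b , ≤-trans (+-mono-≤ Σ≤ (<⇒≤ (≰⇒> Fb≰)))
                             (≤-reflexive (+-comm (suc K * F b) (F b)))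

module _ (f : ℕ → ℕ) where

  fibre : ℕ → List ℕ → List ℕ
  fibre b = filter (λ x → b ≟ f x)

  sumℕ-∣fibre∣ : ∀ K A → All (λ x → f x < K) A → sumℕ K (λ b → length (fibre b A)) ≡ length A
  sumℕ-∣fibre∣ K []       _            = sumℕ-zero K λ _ _ → refl
  sumℕ-∣fibre∣ K (x ∷ xs) (fx<K ∷ xs<K) = begin
    sumℕ K (λ b → length (fibre b (x ∷ xs)))
      ≡⟨ sumℕ-cong K (λ b _ → length-fibre-∷ b) ⟩
    sumℕ K (λ b → indicator (does (b ≟ f x)) + length (fibre b xs))
      ≡⟨ sumℕ-distrib-+ K _ _ ⟩
    sumℕ K (λ b → indicator (does (b ≟ f x))) + sumℕ K (λ b → length (fibre b xs))
      ≡⟨ cong₂ _+_ (sumℕ-indicator-≡ K (f x) fx<K) (sumℕ-∣fibre∣ K xs xs<K) ⟩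
    suc (length xs) ∎
    where
    open ≡-Reasoning
    length-fibre-∷ : ∀ b → length (fibre b (x ∷ xs)) ≡ indicator (does (b ≟ f x)) + length (fibre b xs)
    length-fibre-∷ b with does (b ≟ f x)
    ... | true  = refl
    ... | false = refl

  large-fibre : ∀ K A → 0 < K → All (λ x → f x < K) A → ∃[ b ] length A ≤ K * length (fibre b A)
  large-fibre K A 0<K A<K with sumℕ-≤-max K (λ b → length (fibre b A)) 0<K
  ... | b , Σ≤ = b , subst (_≤ K * length (fibre b A)) (sumℕ-∣fibre∣ K A A<K) Σ≤

injective⇒surjective : ∀ {n} {f : Fin n → Fin n} → Injective _≡_ _≡_ f → ∀ y → ∃[ x ] f x ≡ y
injective⇒surjective {zero}  _     ()
injective⇒surjective {suc n} {f} f-inj y with any? (λ x → f x F.≟ y)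
... | yes hit = hit
... | no miss = contradiction (injective⇒≤ punchOut∘f-injective) 1+n≰n
  where
  y≢f : ∀ x → y ≢ f x
  y≢f x y≡fx = miss (x , sym y≡fx)
  punchOut∘f-injective : Injective _≡_ _≡_ (λ x → punchOut (y≢f x))
  punchOut∘f-injective {x} {x′} = f-inj ∘ punchOut-injective (y≢f x) (y≢f x′)

third : ∀ {m} (i l : Fin (3 + m)) → ∃[ j ] (i ≢ j × l ≢ j)
third i l with F.zero F.≟ i | F.zero F.≟ l
... | no 0≢i | no 0≢l = F.zero , ≢-sym 0≢i , ≢-sym 0≢l
... | yes refl | no 0≢l with F.suc F.zero F.≟ l
...   | no 1≢l   = F.suc F.zero , (λ ()) , ≢-sym 1≢l
...   | yes refl = F.suc (F.suc F.zero) , (λ ()) , (λ ())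
third i l | no 0≢i | yes refl with F.suc F.zero F.≟ i
...   | no 1≢i   = F.suc F.zero , ≢-sym 1≢i , (λ ())
...   | yes refl = F.suc (F.suc F.zero) , (λ ()) , (λ ())
third i l | yes refl | yes refl = F.suc F.zero , (λ ()) , (λ ())

avoid : ∀ {m} → Fin (3 + m) → Fin (3 + m) → Fin (3 + m)
avoid i l = proj₁ (third i l)

avoid≢ˡ : ∀ {m} (i l : Fin (3 + m)) → i ≢ avoid i l
avoid≢ˡ i l = proj₁ (proj₂ (third i l))

avoid≢ʳ : ∀ {m} (i l : Fin (3 + m)) → l ≢ avoid i l
avoid≢ʳ i l = proj₂ (proj₂ (third i l))

length-cartesianProductWith : ∀ {A B C : Set} (f : A → B → C) xs ys →
                              length (cartesianProductWith f xs ys) ≡ length xs * length ys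
length-cartesianProductWith f []       ys = refl
length-cartesianProductWith f (x ∷ xs) ys = begin
  length (map (f x) ys ++ cartesianProductWith f xs ys)
    ≡⟨ length-++ (map (f x) ys) ⟩
  length (map (f x) ys) + length (cartesianProductWith f xs ys)
    ≡⟨ cong₂ _+_ (length-map (f x) ys) (length-cartesianProductWith f xs ys) ⟩
  length ys + length xs * length ys ∎
  where open ≡-Reasoning

unique-map⁺ : ∀ {A B : Set} (f : A → B) {xs} → (∀ {x y} → x ∈ xs → y ∈ xs → f x ≡ f y → x ≡ y) →
              Unique xs → Unique (map f xs)
unique-map⁺ f f-inj []               = []
unique-map⁺ f f-inj (x∉xs ∷ xs-uniq) =
  All.map⁺ (All.tabulate λ y∈xs fx≡fy → All.lookup x∉xs y∈xs (f-inj (here refl) (there y∈xs) fx≡fy))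
  ∷ unique-map⁺ f (λ x∈ y∈ → f-inj (there x∈) (there y∈)) xs-uniq

affine⇒HasAP : ∀ (A : List ℕ) r C T → T ≢ 0ℤ → 0 < r →
               (∀ y → y < r → ∃[ x ] (x ∈ A × + x ≡ C ℤ.+ T ℤ.* + y)) → HasAP r A
affine⇒HasAP A r C (+ zero) T≢0 _ _ = contradiction refl T≢0
affine⇒HasAP A r C (+ suc D) _ 0<r at with at 0 0<r
... | x₀ , _ , x₀≡ = x₀ , suc D , s≤s z≤n , term
  where
  term : ∀ j → j < r → x₀ + j * suc D ∈ A
  term j j<r with at j j<r
  ... | x , x∈A , x≡ = subst (_∈ A) (ℤ.+-injective (begin
    + x
      ≡⟨ x≡ ⟩
    C ℤ.+ + suc D ℤ.* + j
      ≡⟨ solve 3 (λ C T J → C :+ T :* J := (C :+ T :* con (+ 0)) :+ J :* T) refl C (+ suc D) (+ j) ⟩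
    (C ℤ.+ + suc D ℤ.* + 0) ℤ.+ + j ℤ.* + suc D
      ≡⟨ cong₂ ℤ._+_ (sym x₀≡) (sym (ℤ.pos-* j (suc D))) ⟩
    + x₀ ℤ.+ + (j * suc D)
      ≡⟨ ℤ.pos-+ x₀ (j * suc D) ⟨
    + (x₀ + j * suc D) ∎)) x∈A
    where
    open ≡-Reasoning
    open ℤ-Solver.+-*-Solver
affine⇒HasAP A (suc r′) C -[1+ D ] _ _ at with at r′ ≤-refl
... | x₀ , _ , x₀≡ = x₀ , suc D , s≤s z≤n , term
  where
  term : ∀ j → j < suc r′ → x₀ + j * suc D ∈ A
  term j j<r with at (r′ ∸ j) (s≤s (m∸n≤m r′ j))
  ... | x , x∈A , x≡ = subst (_∈ A) (ℤ.+-injective (begin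
    + x
      ≡⟨ x≡ ⟩
    C ℤ.+ - + suc D ℤ.* + (r′ ∸ j)
      ≡⟨ solve 4 (λ C E Y J → C :+ (:- E) :* Y := (C :+ (:- E) :* (Y :+ J)) :+ J :* E) refl C (+ suc D) (+ (r′ ∸ j)) (+ j) ⟩
    (C ℤ.+ - + suc D ℤ.* (+ (r′ ∸ j) ℤ.+ + j)) ℤ.+ + j ℤ.* + suc D
      ≡⟨ cong (λ y → (C ℤ.+ - + suc D ℤ.* y) ℤ.+ + j ℤ.* + suc D) r′∸j+j≡r′ ⟩
    (C ℤ.+ - + suc D ℤ.* + r′) ℤ.+ + j ℤ.* + suc D
      ≡⟨ cong₂ ℤ._+_ (sym x₀≡) (sym (ℤ.pos-* j (suc D))) ⟩
    + x₀ ℤ.+ + (j * suc D)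
      ≡⟨ ℤ.pos-+ x₀ (j * suc D) ⟨
    + (x₀ + j * suc D) ∎)) x∈A
    where
    open ≡-Reasoning
    open ℤ-Solver.+-*-Solver
    r′∸j+j≡r′ : + (r′ ∸ j) ℤ.+ + j ≡ + r′
    r′∸j+j≡r′ = trans (sym (ℤ.pos-+ (r′ ∸ j) j)) (cong +_ (m∸n+n≡m (≤-pred j<r)))

HasAP-mono : ∀ {r A B} → (∀ {x} → x ∈ B → x ∈ A) → HasAP r B → HasAP r A
HasAP-mono B⊆A (a , δ , 1≤δ , terms) = a , δ , 1≤δ , λ j j<r → B⊆A (terms j j<r)

[j*P+l]/P≡j : ∀ P .{{_ : NonZero P}} j l → l < P → (j * P + l) / P ≡ j
[j*P+l]/P≡j P j l l<P = begin
  (j * P + l) / P     ≡⟨ +-distrib-/-∣ˡ l (divides-refl j) ⟩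
  j * P / P + l / P   ≡⟨ cong₂ _+_ (m*n/n≡m j P) (m<n⇒m/n≡0 l<P) ⟩
  j + 0               ≡⟨ +-identityʳ j ⟩
  j                   ∎
  where open ≡-Reasoning

[j*P+l]%P≡l : ∀ P .{{_ : NonZero P}} j l → l < P → (j * P + l) % P ≡ l
[j*P+l]%P≡l P j l l<P = begin
  (j * P + l) % P     ≡⟨ cong (_% P) (+-comm (j * P) l) ⟩
  (l + j * P) % P     ≡⟨ [m+kn]%n≡m%n l j P ⟩
  l % P               ≡⟨ m<n⇒m%n≡m l<P ⟩
  l                   ∎
  where open ≡-Reasoning

-- The vertices from k * P on lie in no transversal.
module Transversal (n P k : ℕ) .{{_ : NonZero P}} (kP≤n : k * P ≤ n) where

  part : Fin n → ℕ
  part w = toℕ w / P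

  label : Fin n → ℕ
  label w = toℕ w % P

  part-label-injective : ∀ {w w′} → part w ≡ part w′ → label w ≡ label w′ → w ≡ w′
  part-label-injective {w} {w′} part≡ label≡ = toℕ-injective (begin
    toℕ w                  ≡⟨ m≡m%n+[m/n]*n (toℕ w) P ⟩
    label w + part w * P   ≡⟨ cong₂ (λ l p → l + p * P) label≡ part≡ ⟩
    label w′ + part w′ * P ≡⟨ m≡m%n+[m/n]*n (toℕ w′) P ⟨
    toℕ w′                 ∎)
    where open ≡-Reasoning

  vertex : ∀ p l → p < k → l < P → Fin n
  vertex p l p<k l<P = fromℕ< (begin-strict
    p * P + l <⟨ +-monoʳ-< (p * P) l<P ⟩
    p * P + P ≡⟨ +-comm (p * P) P ⟩
    suc p * P ≤⟨ *-monoˡ-≤ P p<k ⟩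
    k * P     ≤⟨ kP≤n ⟩
    n         ∎)
    where open ≤-Reasoning

  part-vertex : ∀ p l p<k l<P → part (vertex p l p<k l<P) ≡ p
  part-vertex p l p<k l<P = trans (cong (_/ P) (toℕ-fromℕ< _)) ([j*P+l]/P≡j P p l l<P)

  label-vertex : ∀ p l p<k l<P → label (vertex p l p<k l<P) ≡ l
  label-vertex p l p<k l<P = trans (cong (_% P) (toℕ-fromℕ< _)) ([j*P+l]%P≡l P p l l<P)

  OnTransversal : (ℕ → ℕ) → ℕ → Set
  OnTransversal t x = x / P < k × x % P ≡ t (x / P)

  onTransversal? : ∀ t x → Dec (OnTransversal t x)
  onTransversal? t x = x / P <? k ×-dec x % P ≟ t (x / P)

  transversal : (ℕ → ℕ) → Subset n
  transversal t = tabulate λ w → does (onTransversal? t (toℕ w))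

  ∈-transversal⁻ : ∀ t {w} → w ∈ₛ transversal t → part w < k × label w ≡ t (part w)
  ∈-transversal⁻ t {w} w∈ = invert (subst (Reflects _) does≡true (proof (onTransversal? t (toℕ w))))
    where
    does≡true : does (onTransversal? t (toℕ w)) ≡ true
    does≡true = trans (sym (lookup∘tabulate _ w)) ([]=⇒lookup w∈)

  ∈-transversal⁺ : ∀ t {w} → part w < k → label w ≡ t (part w) → w ∈ₛ transversal t
  ∈-transversal⁺ t {w} part<k label≡ = lookup⇒[]= w (transversal t)
    (trans (lookup∘tabulate _ w) (dec-true (onTransversal? t (toℕ w)) (part<k , label≡)))

  Bounded : (ℕ → ℕ) → Set
  Bounded t = ∀ p → p < k → t p < P

  vertex-∈-transversal : ∀ {t} (t<P : Bounded t) p (p<k : p < k) → vertex p (t p) p<k (t<P p p<k) ∈ₛ transversal t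
  vertex-∈-transversal {t} t<P p p<k = ∈-transversal⁺ t
    (subst (_< k) (sym (part-vertex _ _ p<k (t<P p p<k))) p<k)
    (trans (label-vertex _ _ p<k (t<P p p<k)) (cong t (sym (part-vertex _ _ p<k (t<P p p<k)))))

  transversal-injective : ∀ {t t′} → Bounded t → transversal t ≡ transversal t′ → ∀ p → p < k → t p ≡ t′ p
  transversal-injective {t} {t′} t<P t≡t′ p p<k = begin
    t p               ≡⟨ label-vertex p (t p) p<k (t<P p p<k) ⟨
    label w           ≡⟨ proj₂ (∈-transversal⁻ t′ (subst (w ∈ₛ_) t≡t′ (vertex-∈-transversal t<P p p<k))) ⟩
    t′ (part w)       ≡⟨ cong t′ (part-vertex p (t p) p<k (t<P p p<k)) ⟩
    t′ p              ∎
    where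
    open ≡-Reasoning
    w : Fin n
    w = vertex p (t p) p<k (t<P p p<k)

  ∣transversal∣ : ∀ {t} → Bounded t → ∣ transversal t ∣ ≡ k
  ∣transversal∣ {t} t<P = begin
    ∣ transversal t ∣                                        ≡⟨ ∣tabulate∣ n _ ⟩
    sumℕ n χ                                                 ≡⟨ cong (λ c → sumℕ c χ) (m+[n∸m]≡n kP≤n) ⟨
    sumℕ (k * P + (n ∸ k * P)) χ                             ≡⟨ sumℕ-+ (k * P) (n ∸ k * P) χ ⟩
    sumℕ (k * P) χ + sumℕ (n ∸ k * P) (λ x → χ (k * P + x))  ≡⟨ cong₂ _+_ (sumℕ-* k P χ) (sumℕ-zero _ outside) ⟩
    sumℕ k (λ j → sumℕ P (λ x → χ (j * P + x))) + 0         ≡⟨ cong (_+ 0) (sumℕ-cong k block) ⟩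
    sumℕ k (λ _ → 1) + 0                                     ≡⟨ cong (_+ 0) (sumℕ-const k 1) ⟩
    k * 1 + 0                                                ≡⟨ cong (_+ 0) (*-identityʳ k) ⟩
    k + 0                                                    ≡⟨ +-identityʳ k ⟩
    k                                                        ∎
    where
    open ≡-Reasoning
    χ : ℕ → ℕ
    χ x = indicator (does (onTransversal? t x))
    outside : ∀ x → x < n ∸ k * P → χ (k * P + x) ≡ 0
    outside x _ = cong indicator (dec-false (onTransversal? t (k * P + x)) λ (lt , _) →
      <⇒≱ lt (≤-trans (≤-reflexive (sym (m*n/n≡m k P))) (/-monoˡ-≤ P (m≤m+n (k * P) x))))
    block : ∀ j → j < k → sumℕ P (λ x → χ (j * P + x)) ≡ 1
    block j j<k = trans (sumℕ-cong P λ x x<P → cong indicator (inBlock x x<P)) (sumℕ-indicator-≡ P (t j) (t<P j j<k))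
      where
      inBlock : ∀ x → x < P → does (onTransversal? t (j * P + x)) ≡ does (x ≟ t j)
      inBlock x x<P rewrite [j*P+l]/P≡j P j x x<P | [j*P+l]%P≡l P j x x<P | dec-true (j <? k) j<k = refl

image-∈⁻ : ∀ {V : Set} {n} (φ : V → Fin n) (e : List V) {x} → x ∈ₛ image φ e → ∃[ v ] (v ∈ e × x ≡ φ v)
image-∈⁻ φ []      x∈ = ⊥-elim (∉⊥ x∈)
image-∈⁻ φ (v ∷ e) x∈ with x∈p∪q⁻ ⁅ φ v ⁆ (image φ e) x∈
... | inj₁ x∈⁅φv⁆ = v , here refl , x∈⁅y⁆⇒x≡y (φ v) x∈⁅φv⁆
... | inj₂ x∈φe with image-∈⁻ φ e x∈φe
...   | u , u∈e , x≡φu = u , there u∈e , x≡φu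

image-∈⁺ : ∀ {V : Set} {n} (φ : V → Fin n) (e : List V) {v} → v ∈ e → φ v ∈ₛ image φ e
image-∈⁺ φ (u ∷ e) (here refl) = x∈p∪q⁺ (inj₁ (x∈⁅x⁆ (φ u)))
image-∈⁺ φ (u ∷ e) (there v∈e) = x∈p∪q⁺ (inj₂ (image-∈⁺ φ e v∈e))

module QEdges (a r : ℕ) where

  Vertex : Set
  Vertex = Fin a ⊎ (Fin r ⊎ Fin r)

  b c : Fin r → Vertex
  b i = inj₂ (inj₁ i)
  c i = inj₂ (inj₂ i)

  -- Defs.Q keeps its edge list local; this copy agrees with it definitionally.
  edge : Fin r → List Vertex
  edge i = map inj₁ (allFin a)
        ++ map (inj₂ ∘ inj₁) (filter (λ j → ¬? (j F.≟ i)) (allFin r))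
        ++ (inj₂ (inj₂ i) ∷ [])

  InEdge : Fin r → Vertex → Set
  InEdge i (inj₁ _)        = ⊤
  InEdge i (inj₂ (inj₁ j)) = j ≢ i
  InEdge i (inj₂ (inj₂ j)) = j ≡ i

  ∈-edge⁺ : ∀ i v → InEdge i v → v ∈ edge i
  ∈-edge⁺ i (inj₁ x)        _    = ∈-++⁺ˡ (∈-map⁺ inj₁ (∈-allFin x))
  ∈-edge⁺ i (inj₂ (inj₁ j)) j≢i  = ∈-++⁺ʳ (map inj₁ (allFin a))
    (∈-++⁺ˡ (∈-map⁺ (inj₂ ∘ inj₁) (∈-filter⁺ (λ j → ¬? (j F.≟ i)) (∈-allFin j) j≢i)))
  ∈-edge⁺ i (inj₂ (inj₂ j)) refl = ∈-++⁺ʳ (map inj₁ (allFin a)) (∈-++⁺ʳ _ (here refl))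

  ∈-edge⁻ : ∀ i v → v ∈ edge i → InEdge i v
  ∈-edge⁻ i v v∈ with ∈-++⁻ (map inj₁ (allFin a)) v∈
  ... | inj₁ v∈A with ∈-map⁻ inj₁ v∈A
  ...   | _ , _ , refl = tt
  ∈-edge⁻ i v v∈ | inj₂ v∈BC with ∈-++⁻ (map (inj₂ ∘ inj₁) (filter (λ j → ¬? (j F.≟ i)) (allFin r))) v∈BC
  ... | inj₁ v∈B with ∈-map⁻ (inj₂ ∘ inj₁) v∈B
  ...   | j , j∈ , refl = proj₂ (∈-filter⁻ (λ j → ¬? (j F.≟ i)) {xs = allFin r} j∈)
  ∈-edge⁻ i v v∈ | inj₂ v∈BC | inj₂ (here refl) = refl

-- The edges of a copy of Q_k(r) in a transversal hypergraph, read as tuples: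
-- pos i is the part of b_i and c_i, where tuple i alone leaves the common value.
record QTuples (k r : ℕ) : Set where
  field
    tuple         : Fin r → ℕ → ℕ
    pos           : Fin r → ℕ
    pos<k         : ∀ i → pos i < k
    pos-injective : Injective _≡_ _≡_ pos
    common        : Fin r → ℕ
    tuple-common  : ∀ i j → j ≢ i → tuple j (pos i) ≡ common i
    own≢common    : ∀ i → tuple i (pos i) ≢ common i
    agree         : ∀ i j p → i ≢ j → p < k → p ≢ pos i → p ≢ pos j → tuple i p ≡ tuple j p

module CopyInTransversal
  (n P k : ℕ) .{{_ : NonZero P}} (kP≤n : k * P ≤ n) (a m : ℕ)
  (φ : QEdges.Vertex a (3 + m) → Fin n) (φ-injective : Injective _≡_ _≡_ φ)
  (t : Fin (3 + m) → ℕ → ℕ) (t<P : ∀ i → Transversal.Bounded n P k kP≤n (t i))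
  (edge≡ : ∀ i → image φ (QEdges.edge a (3 + m) i) ≡ Transversal.transversal n P k kP≤n (t i))
  where

  open Transversal n P k kP≤n
  open QEdges a (3 + m)

  on-transversal : ∀ i v → InEdge i v → part (φ v) < k × label (φ v) ≡ t i (part (φ v))
  on-transversal i v v∈i = ∈-transversal⁻ (t i) (subst (φ v ∈ₛ_) (edge≡ i) (image-∈⁺ φ (edge i) (∈-edge⁺ i v v∈i)))

  hits-part : ∀ i p → p < k → ∃[ v ] (InEdge i v × part (φ v) ≡ p)
  hits-part i p p<k =
    let v , v∈i , w≡φv = image-∈⁻ φ (edge i) (subst (w ∈ₛ_) (sym (edge≡ i)) (vertex-∈-transversal (t<P i) p p<k)) in
    v , ∈-edge⁻ i v v∈i , trans (cong part (sym w≡φv)) (part-vertex p (t i p) p<k (t<P i p p<k))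
    where
    w : Fin n
    w = vertex p (t i p) p<k (t<P i p p<k)

  same-part⇒≡ : ∀ j u v → InEdge j u → InEdge j v → part (φ u) ≡ part (φ v) → u ≡ v
  same-part⇒≡ j u v u∈j v∈j part≡ = φ-injective (part-label-injective part≡ (begin
    label (φ u)      ≡⟨ proj₂ (on-transversal j u u∈j) ⟩
    t j (part (φ u)) ≡⟨ cong (t j) part≡ ⟩
    t j (part (φ v)) ≡⟨ proj₂ (on-transversal j v v∈j) ⟨
    label (φ v)      ∎))
    where open ≡-Reasoning

  pos : Fin (3 + m) → ℕ
  pos i = part (φ (b i))

  pos<k : ∀ i → pos i < k
  pos<k i = proj₁ (on-transversal (avoid i i) (b i) (avoid≢ˡ i i))

  pos-injective : Injective _≡_ _≡_ pos
  pos-injective {i} {l} pos≡ with same-part⇒≡ (avoid i l) (b i) (b l) (avoid≢ˡ i l) (avoid≢ʳ i l) pos≡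
  ... | refl = refl

  at-pos⇒c : ∀ i v → InEdge i v → part (φ v) ≡ pos i → v ≡ c i
  at-pos⇒c i (inj₁ x) _ part≡ with same-part⇒≡ (avoid i i) (inj₁ x) (b i) tt (avoid≢ˡ i i) part≡
  ... | ()
  at-pos⇒c i (inj₂ (inj₁ l)) l≢i part≡ with same-part⇒≡ (avoid i l) (b l) (b i) (avoid≢ʳ i l) (avoid≢ˡ i l) part≡
  ... | refl = ⊥-elim (l≢i refl)
  at-pos⇒c i (inj₂ (inj₂ j)) refl _ = refl

  part-c : ∀ i → part (φ (c i)) ≡ pos i
  part-c i = let v , v∈i , part≡ = hits-part i (pos i) (pos<k i) in
    subst (λ u → part (φ u) ≡ pos i) (at-pos⇒c i v v∈i part≡) part≡

  qTuples : QTuples k (3 + m)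
  qTuples = record
    { tuple         = t
    ; pos           = pos
    ; pos<k         = pos<k
    ; pos-injective = pos-injective
    ; common        = λ i → label (φ (b i))
    ; tuple-common  = λ i j j≢i → sym (proj₂ (on-transversal j (b i) (≢-sym j≢i)))
    ; own≢common    = own≢common
    ; agree         = agree
    }
    where
    own≢common : ∀ i → t i (pos i) ≢ label (φ (b i))
    own≢common i own≡common = c≢b (φ-injective (part-label-injective (part-c i) (begin
      label (φ (c i))      ≡⟨ proj₂ (on-transversal i (c i) refl) ⟩
      t i (part (φ (c i))) ≡⟨ cong (t i) (part-c i) ⟩
      t i (pos i)          ≡⟨ own≡common ⟩
      label (φ (b i))      ∎)))
      where
      open ≡-Reasoning
      c≢b : c i ≢ b i
      c≢b ()
    agree : ∀ i j p → i ≢ j → p < k → p ≢ pos i → p ≢ pos j → t i p ≡ t j p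
    agree i j p i≢j p<k p≢i p≢j with hits-part i p p<k
    ... | inj₂ (inj₂ i′) , refl , part≡ = ⊥-elim (p≢i (trans (sym part≡) (part-c i)))
    ... | inj₁ x , _ , refl = trans (sym (proj₂ (on-transversal i (inj₁ x) tt))) (proj₂ (on-transversal j (inj₁ x) tt))
    ... | inj₂ (inj₁ l) , l≢i , refl with l F.≟ j
    ...   | yes refl = ⊥-elim (p≢j refl)
    ...   | no l≢j   = trans (sym (proj₂ (on-transversal i (b l) l≢i))) (proj₂ (on-transversal j (b l) l≢j))

dot : ℕ → (ℕ → ℤ) → (ℕ → ℕ) → ℤ
dot k c t = sumℤ k (λ p → c p ℤ.* + t p)

*-≢0 : ∀ {i j} → i ≢ 0ℤ → j ≢ 0ℤ → i ℤ.* j ≢ 0ℤ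
*-≢0 {i} i≢0 j≢0 ij≡0 with ℤ.i*j≡0⇒i≡0∨j≡0 i ij≡0
... | inj₁ i≡0 = i≢0 i≡0
... | inj₂ j≡0 = j≢0 j≡0

module _ {k r} (qt : QTuples k r) where

  open QTuples qt
  open ℤ-Solver.+-*-Solver

  jump : Fin r → ℤ
  jump i = + tuple i (pos i) ℤ.- + common i

  jump≢0 : ∀ i → jump i ≢ 0ℤ
  jump≢0 i jump≡0 = own≢common i (ℤ.+-injective (ℤ.i-j≡0⇒i≡j _ _ jump≡0))

  dot-difference : ∀ c {i j} → i ≢ j →
                   dot k c (tuple i) ℤ.- dot k c (tuple j) ≡ c (pos i) ℤ.* jump i ℤ.- c (pos j) ℤ.* jump j
  dot-difference c {i} {j} i≢j = begin
    dot k c (tuple i) ℤ.- dot k c (tuple j) ≡⟨ sumℤ-distrib-- k _ _ ⟨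
    sumℤ k term                             ≡⟨ sumℤ-pair k term (pos i) (pos j) (pos<k i) (pos<k j) (i≢j ∘′ pos-injective) off ⟩
    term (pos i) ℤ.+ term (pos j)           ≡⟨ cong₂ ℤ._+_ at-i at-j ⟩
    c (pos i) ℤ.* jump i ℤ.- c (pos j) ℤ.* jump j ∎
    where
    open ≡-Reasoning
    term : ℕ → ℤ
    term p = c p ℤ.* + tuple i p ℤ.- c p ℤ.* + tuple j p
    off : ∀ p → p < k → p ≢ pos i → p ≢ pos j → term p ≡ 0ℤ
    off p p<k p≢i p≢j rewrite agree i j p i≢j p<k p≢i p≢j = ℤ.+-inverseʳ (c p ℤ.* + tuple j p)
    at-i : term (pos i) ≡ c (pos i) ℤ.* jump i
    at-i rewrite tuple-common i j (≢-sym i≢j) =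
      solve 3 (λ c x y → c :* x :- c :* y := c :* (x :- y)) refl (c (pos i)) (+ tuple i (pos i)) (+ common i)
    at-j : term (pos j) ≡ - (c (pos j) ℤ.* jump j)
    at-j rewrite tuple-common j i i≢j =
      solve 3 (λ c x y → c :* y :- c :* x := :- (c :* (x :- y))) refl (c (pos j)) (+ tuple j (pos j)) (+ common j)

module Weights (s d : ℕ) where

  open ℤ-Solver.+-*-Solver

  weight : ℕ → ℤ
  weight p with p <? s
  ... | yes _ = 0ℤ
  ... | no _ with p ≟ d
  ...   | yes _ = -1ℤ
  ...   | no _  = 1ℤ

  moment : ℕ → ℤ
  moment p = (+ p ℤ.- + d) ℤ.* weight p

  weight-low : ∀ {p} → p < s → weight p ≡ 0ℤ
  weight-low {p} p<s with p <? s
  ... | yes _  = refl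
  ... | no p≮s = contradiction p<s p≮s

  weight-high : ∀ {p} → s ≤ p → p ≢ d → weight p ≡ 1ℤ
  weight-high {p} s≤p p≢d with p <? s
  ... | yes p<s = contradiction s≤p (<⇒≱ p<s)
  ... | no _ with p ≟ d
  ...   | yes p≡d = contradiction p≡d p≢d
  ...   | no _    = refl

  weight-d : s ≤ d → weight d ≡ -1ℤ
  weight-d s≤d with d <? s
  ... | yes d<s = contradiction s≤d (<⇒≱ d<s)
  ... | no _ with d ≟ d
  ...   | yes _   = refl
  ...   | no d≢d  = contradiction refl d≢d

  weight-high≢0 : ∀ {p} → s ≤ p → weight p ≢ 0ℤ
  weight-high≢0 {p} s≤p with p ≟ d
  ... | yes refl = λ w≡0 → case trans (sym (weight-d s≤p)) w≡0 of λ ()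
  ... | no p≢d   = λ w≡0 → case trans (sym (weight-high s≤p p≢d)) w≡0 of λ ()

  module _ {k} (qt : QTuples k (suc s)) (k≤ : k ≤ s + suc s)
           (balanced : ∀ i → dot k weight (QTuples.tuple qt i) ≡ 0ℤ) where

    open QTuples qt

    jumps-cancel : ∀ c {i j} → i ≢ j → dot k c (tuple i) ≡ 0ℤ → dot k c (tuple j) ≡ 0ℤ →
                   c (pos i) ℤ.* jump qt i ≡ c (pos j) ℤ.* jump qt j
    jumps-cancel c i≢j dot-i dot-j = ℤ.i-j≡0⇒i≡j _ _ (trans (sym (dot-difference qt c i≢j))
                                                          (cong₂ ℤ._-_ dot-i dot-j))

    -- By balancing, one position below s forces all r of them below s = r − 1.
    all-high : ∀ i → s ≤ pos i
    all-high i = ≮⇒≥ λ pos-i<s → <⇒notInjective ≤-refl (low-injective (all-low pos-i<s))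
      where
      all-low : pos i < s → ∀ j → pos j < s
      all-low pos-i<s j with i F.≟ j
      ... | yes refl = pos-i<s
      ... | no i≢j = ≰⇒> λ s≤pos-j → *-≢0 (weight-high≢0 s≤pos-j) (jump≢0 qt j)
        (trans (sym (jumps-cancel weight i≢j (balanced i) (balanced j)))
               (cong (ℤ._* jump qt i) (weight-low pos-i<s)))
      low-injective : (low : ∀ j → pos j < s) → Injective _≡_ _≡_ (λ j → fromℕ< (low j))
      low-injective low {j} {j′} = pos-injective ∘′ fromℕ<-injective (pos j) (pos j′) (low j) (low j′)

    slope : ℤ
    slope = weight (pos F.zero) ℤ.* jump qt F.zero

    slope≢0 : slope ≢ 0ℤ
    slope≢0 = *-≢0 (weight-high≢0 (all-high F.zero)) (jump≢0 qt F.zero)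

    weight*jump≡slope : ∀ i → weight (pos i) ℤ.* jump qt i ≡ slope
    weight*jump≡slope i with i F.≟ F.zero
    ... | yes refl = refl
    ... | no i≢0   = jumps-cancel weight i≢0 (balanced i) (balanced F.zero)

    moment-difference : ∀ i → dot k moment (tuple i) ℤ.- dot k moment (tuple F.zero)
                              ≡ slope ℤ.* (+ pos i ℤ.- + pos F.zero)
    moment-difference i with i F.≟ F.zero
    ... | yes refl = trans (ℤ.+-inverseʳ (dot k moment (tuple F.zero)))
                           (sym (trans (cong (slope ℤ.*_) (ℤ.+-inverseʳ (+ pos F.zero))) (ℤ.*-zeroʳ slope)))
    ... | no i≢0 = begin
      dot k moment (tuple i) ℤ.- dot k moment (tuple F.zero)
        ≡⟨ dot-difference qt moment i≢0 ⟩
      moment (pos i) ℤ.* jump qt i ℤ.- moment (pos F.zero) ℤ.* jump qt F.zero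
        ≡⟨ cong₂ ℤ._-_ (ℤ.*-assoc (+ pos i ℤ.- + d) _ _) (ℤ.*-assoc (+ pos F.zero ℤ.- + d) _ _) ⟩
      (+ pos i ℤ.- + d) ℤ.* (weight (pos i) ℤ.* jump qt i)
        ℤ.- (+ pos F.zero ℤ.- + d) ℤ.* (weight (pos F.zero) ℤ.* jump qt F.zero)
        ≡⟨ cong (λ u → (+ pos i ℤ.- + d) ℤ.* u ℤ.- (+ pos F.zero ℤ.- + d) ℤ.* slope) (weight*jump≡slope i) ⟩
      (+ pos i ℤ.- + d) ℤ.* slope ℤ.- (+ pos F.zero ℤ.- + d) ℤ.* slope
        ≡⟨ solve 4 (λ x y d T → (x :- d) :* T :- (y :- d) :* T := T :* (x :- y)) refl (+ pos i) (+ pos F.zero) (+ d) slope ⟩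
      slope ℤ.* (+ pos i ℤ.- + pos F.zero) ∎
      where open ≡-Reasoning

    pos∸s<1+s : ∀ i → pos i ∸ s < suc s
    pos∸s<1+s i = +-cancelˡ-< s (pos i ∸ s) (suc s)
      (subst (_< s + suc s) (sym (m+[n∸m]≡n (all-high i))) (<-≤-trans (pos<k i) k≤))

    offset : Fin (suc s) → Fin (suc s)
    offset i = fromℕ< (pos∸s<1+s i)

    pos≡s+offset : ∀ i → pos i ≡ s + toℕ (offset i)
    pos≡s+offset i = trans (sym (m+[n∸m]≡n (all-high i))) (cong (_+_ s) (sym (toℕ-fromℕ< (pos∸s<1+s i))))

    offset-injective : Injective _≡_ _≡_ offset
    offset-injective {i} {j} offset≡ =
      pos-injective (trans (pos≡s+offset i) (trans (cong (λ o → s + toℕ o) offset≡) (sym (pos≡s+offset j))))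

    intercept : ℤ
    intercept = dot k moment (tuple F.zero) ℤ.+ slope ℤ.* (+ s ℤ.- + pos F.zero)

    moment-affine : ∀ i → dot k moment (tuple i) ≡ intercept ℤ.+ slope ℤ.* + toℕ (offset i)
    moment-affine i = begin
      dot k moment (tuple i)
        ≡⟨ solve 2 (λ a b → a := b :+ (a :- b)) refl (dot k moment (tuple i)) α₀ ⟩
      α₀ ℤ.+ (dot k moment (tuple i) ℤ.- α₀)
        ≡⟨ cong (ℤ._+_ α₀) (moment-difference i) ⟩
      α₀ ℤ.+ slope ℤ.* (+ pos i ℤ.- + pos F.zero)
        ≡⟨ cong (λ p → α₀ ℤ.+ slope ℤ.* (+ p ℤ.- + pos F.zero)) (pos≡s+offset i) ⟩
      α₀ ℤ.+ slope ℤ.* (+ (s + o) ℤ.- + pos F.zero)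
        ≡⟨ cong (λ z → α₀ ℤ.+ slope ℤ.* (z ℤ.- + pos F.zero)) (ℤ.pos-+ s o) ⟩
      α₀ ℤ.+ slope ℤ.* ((+ s ℤ.+ + o) ℤ.- + pos F.zero)
        ≡⟨ solve 5 (λ a T S Y P → a :+ T :* ((S :+ Y) :- P) := (a :+ T :* (S :- P)) :+ T :* Y) refl α₀ slope (+ s) (+ o) (+ pos F.zero) ⟩
      intercept ℤ.+ slope ℤ.* + o ∎
      where
      open ≡-Reasoning
      α₀ : ℤ
      α₀ = dot k moment (tuple F.zero)
      o : ℕ
      o = toℕ (offset i)

    moments-affine : ∃[ C ] ∀ y → y < suc s → ∃[ i ] dot k moment (tuple i) ≡ C ℤ.+ slope ℤ.* + y
    moments-affine = intercept , λ y y<1+s →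
      let i , offset≡y = injective⇒surjective offset-injective (fromℕ< y<1+s) in
      i , trans (moment-affine i) (cong (λ o → intercept ℤ.+ slope ℤ.* + o) (trans (cong toℕ offset≡y) (toℕ-fromℕ< y<1+s)))

nth : List ℕ → ℕ → ℕ
nth []      _       = 0
nth (x ∷ v) zero    = x
nth (x ∷ v) (suc p) = nth v p

module Tuples (r₂ : ℕ) where

  open ℤ-Solver.+-*-Solver

  s d k : ℕ
  s = suc r₂
  d = s + r₂
  k = suc (suc d)

  open Weights s d public

  total weighted : List ℕ → ℕ
  total    v = sumℕ r₂ λ y → nth v (s + y)
  weighted v = sumℕ r₂ λ y → (r₂ ∸ y) * nth v (s + y)

  -- The two last coordinates make `weight` vanish and `moment` equal a.
  tuple : List ℕ → ℕ → ℕ → ℕ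
  tuple v a p with p <? d
  ... | yes _ = nth v p
  ... | no _ with p ≟ d
  ...   | yes _ = a + weighted v + total v
  ...   | no _  = a + weighted v

  tuple-< : ∀ v a {p} → p < d → tuple v a p ≡ nth v p
  tuple-< v a {p} p<d with p <? d
  ... | yes _  = refl
  ... | no p≮d = contradiction p<d p≮d

  tuple-d : ∀ v a → tuple v a d ≡ a + weighted v + total v
  tuple-d v a with d <? d
  ... | yes d<d = contradiction d<d (<-irrefl refl)
  ... | no _ with d ≟ d
  ...   | yes _   = refl
  ...   | no d≢d  = contradiction refl d≢d

  tuple-1+d : ∀ v a → tuple v a (suc d) ≡ a + weighted v
  tuple-1+d v a with suc d <? d
  ... | yes 1+d<d = contradiction 1+d<d (<-asym (n<1+n d))
  ... | no _ with suc d ≟ d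
  ...   | yes 1+d≡d = contradiction 1+d≡d (1+n≢n)
  ...   | no _      = refl

  dot-k : ∀ c t → dot k c t ≡ sumℤ s (λ p → c p ℤ.* + t p) ℤ.+ sumℤ r₂ (λ y → c (s + y) ℤ.* + t (s + y))
                               ℤ.+ c d ℤ.* + t d ℤ.+ c (suc d) ℤ.* + t (suc d)
  dot-k c t = cong (λ σ → σ ℤ.+ c d ℤ.* + t d ℤ.+ c (suc d) ℤ.* + t (suc d)) (sumℤ-+ s r₂ _)

  s+y<d : ∀ {y} → y < r₂ → s + y < d
  s+y<d = +-monoʳ-< s

  tuple-balanced : ∀ v a → dot k weight (tuple v a) ≡ 0ℤ
  tuple-balanced v a = begin
    dot k weight (tuple v a)
      ≡⟨ dot-k weight (tuple v a) ⟩
    sumℤ s (λ p → weight p ℤ.* + tuple v a p) ℤ.+ sumℤ r₂ (λ y → weight (s + y) ℤ.* + tuple v a (s + y))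
      ℤ.+ weight d ℤ.* + tuple v a d ℤ.+ weight (suc d) ℤ.* + tuple v a (suc d)
      ≡⟨ cong₂ (λ σ τ → σ ℤ.+ τ ℤ.+ weight d ℤ.* + tuple v a d ℤ.+ weight (suc d) ℤ.* + tuple v a (suc d))
               (sumℤ-zero s λ p p<s → cong (ℤ._* + tuple v a p) (weight-low p<s))
               (trans (sumℤ-cong r₂ λ y y<r₂ → middle y<r₂) (sumℤ-pos r₂ _)) ⟩
    0ℤ ℤ.+ + total v ℤ.+ weight d ℤ.* + tuple v a d ℤ.+ weight (suc d) ℤ.* + tuple v a (suc d)
      ≡⟨ cong₂ (λ x z → 0ℤ ℤ.+ + total v ℤ.+ x ℤ.* + tuple v a d ℤ.+ z ℤ.* + tuple v a (suc d))
               (weight-d (m≤m+n s r₂)) (weight-high (≤-trans (m≤m+n s r₂) (n≤1+n d)) 1+n≢n) ⟩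
    0ℤ ℤ.+ + total v ℤ.+ -1ℤ ℤ.* + tuple v a d ℤ.+ 1ℤ ℤ.* + tuple v a (suc d)
      ≡⟨ cong₂ (λ x z → 0ℤ ℤ.+ + total v ℤ.+ -1ℤ ℤ.* + x ℤ.+ 1ℤ ℤ.* + z) (tuple-d v a) (tuple-1+d v a) ⟩
    0ℤ ℤ.+ + total v ℤ.+ -1ℤ ℤ.* + (a + weighted v + total v) ℤ.+ 1ℤ ℤ.* + (a + weighted v)
      ≡⟨ cong₂ (λ x z → 0ℤ ℤ.+ + total v ℤ.+ -1ℤ ℤ.* x ℤ.+ 1ℤ ℤ.* z)
               (trans (ℤ.pos-+ (a + weighted v) (total v)) (cong (ℤ._+ + total v) (ℤ.pos-+ a (weighted v))))
               (ℤ.pos-+ a (weighted v)) ⟩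
    0ℤ ℤ.+ + total v ℤ.+ -1ℤ ℤ.* (+ a ℤ.+ + weighted v ℤ.+ + total v) ℤ.+ 1ℤ ℤ.* (+ a ℤ.+ + weighted v)
      ≡⟨ solve 3 (λ A B C → con 0ℤ :+ C :+ con -1ℤ :* (A :+ B :+ C) :+ con 1ℤ :* (A :+ B) := con 0ℤ) refl (+ a) (+ weighted v) (+ total v) ⟩
    0ℤ ∎
    where
    open ≡-Reasoning
    middle : ∀ {y} → y < r₂ → weight (s + y) ℤ.* + tuple v a (s + y) ≡ + nth v (s + y)
    middle {y} y<r₂ rewrite weight-high (m≤m+n s y) (<⇒≢ (s+y<d y<r₂)) | tuple-< v a (s+y<d y<r₂) = ℤ.*-identityˡ _

  moment-middle : ∀ {y} g → y < r₂ → moment (s + y) ℤ.* + g ≡ - + ((r₂ ∸ y) * g)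
  moment-middle {y} g y<r₂ = begin
    (+ (s + y) ℤ.- + (s + r₂)) ℤ.* weight (s + y) ℤ.* + g
      ≡⟨ cong (λ w → (+ (s + y) ℤ.- + (s + r₂)) ℤ.* w ℤ.* + g) (weight-high (m≤m+n s y) (<⇒≢ (s+y<d y<r₂))) ⟩
    (+ (s + y) ℤ.- + (s + r₂)) ℤ.* 1ℤ ℤ.* + g
      ≡⟨ cong (λ e → (+ (s + y) ℤ.- + (s + e)) ℤ.* 1ℤ ℤ.* + g) (m∸n+n≡m (<⇒≤ y<r₂)) ⟨
    (+ (s + y) ℤ.- + (s + ((r₂ ∸ y) + y))) ℤ.* 1ℤ ℤ.* + g
      ≡⟨ cong₂ (λ u w → (u ℤ.- w) ℤ.* 1ℤ ℤ.* + g) (ℤ.pos-+ s y) (trans (ℤ.pos-+ s _) (cong (ℤ._+_ (+ s)) (ℤ.pos-+ (r₂ ∸ y) y))) ⟩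
    ((+ s ℤ.+ + y) ℤ.- (+ s ℤ.+ (+ (r₂ ∸ y) ℤ.+ + y))) ℤ.* 1ℤ ℤ.* + g
      ≡⟨ solve 4 (λ S Y E G → ((S :+ Y) :- (S :+ (E :+ Y))) :* con 1ℤ :* G := :- (E :* G)) refl (+ s) (+ y) (+ (r₂ ∸ y)) (+ g) ⟩
    - (+ (r₂ ∸ y) ℤ.* + g)
      ≡⟨ cong -_ (ℤ.pos-* (r₂ ∸ y) g) ⟨
    - + ((r₂ ∸ y) * g) ∎
    where open ≡-Reasoning

  tuple-moment : ∀ v a → dot k moment (tuple v a) ≡ + a
  tuple-moment v a = begin
    dot k moment (tuple v a)
      ≡⟨ dot-k moment (tuple v a) ⟩
    sumℤ s (λ p → moment p ℤ.* + tuple v a p) ℤ.+ sumℤ r₂ (λ y → moment (s + y) ℤ.* + tuple v a (s + y))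
      ℤ.+ moment d ℤ.* + tuple v a d ℤ.+ moment (suc d) ℤ.* + tuple v a (suc d)
      ≡⟨ cong₂ (λ σ τ → σ ℤ.+ τ ℤ.+ moment d ℤ.* + tuple v a d ℤ.+ moment (suc d) ℤ.* + tuple v a (suc d))
               (sumℤ-zero s λ p p<s → low p<s)
               (trans (sumℤ-cong r₂ λ y y<r₂ → middle y<r₂) (trans (sumℤ-neg r₂ _) (cong -_ (sumℤ-pos r₂ _)))) ⟩
    0ℤ ℤ.+ - + weighted v ℤ.+ moment d ℤ.* + tuple v a d ℤ.+ moment (suc d) ℤ.* + tuple v a (suc d)
      ≡⟨ cong₂ (λ x z → 0ℤ ℤ.+ - + weighted v ℤ.+ x ℤ.+ z) at-d at-1+d ⟩
    0ℤ ℤ.+ - + weighted v ℤ.+ 0ℤ ℤ.+ (+ a ℤ.+ + weighted v)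
      ≡⟨ solve 2 (λ A B → con 0ℤ :+ :- B :+ con 0ℤ :+ (A :+ B) := A) refl (+ a) (+ weighted v) ⟩
    + a ∎
    where
    open ≡-Reasoning
    low : ∀ {p} → p < s → moment p ℤ.* + tuple v a p ≡ 0ℤ
    low {p} p<s rewrite weight-low p<s | ℤ.*-zeroʳ (+ p ℤ.- + d) = refl
    middle : ∀ {y} → y < r₂ → moment (s + y) ℤ.* + tuple v a (s + y) ≡ - + ((r₂ ∸ y) * nth v (s + y))
    middle {y} y<r₂ rewrite tuple-< v a (s+y<d y<r₂) = moment-middle (nth v (s + y)) y<r₂
    at-d : moment d ℤ.* + tuple v a d ≡ 0ℤ
    at-d rewrite ℤ.+-inverseʳ (+ d) = refl
    at-1+d : moment (suc d) ℤ.* + tuple v a (suc d) ≡ + a ℤ.+ + weighted v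
    at-1+d rewrite weight-high (≤-trans (m≤m+n s r₂) (n≤1+n d)) 1+n≢n | tuple-1+d v a =
      trans (cong (λ x → (x ℤ.- + d) ℤ.* 1ℤ ℤ.* + (a + weighted v)) (ℤ.pos-+ 1 d))
            (trans (solve 2 (λ D X → ((con 1ℤ :+ D) :- D) :* con 1ℤ :* X := X) refl (+ d) (+ (a + weighted v)))
                   (ℤ.pos-+ a (weighted v)))

  labels : ℕ → ℕ
  labels m = suc (m + r₂ * (r₂ * m) + r₂ * m)

  module _ {m v} (v<m : ∀ p → p < d → nth v p < m) where

    total-≤ : total v ≤ r₂ * m
    total-≤ = sumℕ-≤ r₂ _ m λ y y<r₂ → <⇒≤ (v<m (s + y) (s+y<d y<r₂))

    weighted-≤ : weighted v ≤ r₂ * (r₂ * m)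
    weighted-≤ = sumℕ-≤ r₂ _ (r₂ * m) λ y y<r₂ → *-mono-≤ (m∸n≤m r₂ y) (<⇒≤ (v<m (s + y) (s+y<d y<r₂)))

    tuple-bounded : ∀ {a} → a ≤ m → ∀ p → p < k → tuple v a p < labels m
    tuple-bounded {a} a≤m p p<k with p <? d
    ... | yes p<d = ≤-trans (v<m p p<d) (≤-trans (≤-trans (m≤m+n m _) (m≤m+n _ (r₂ * m))) (n≤1+n _))
    ... | no _ with p ≟ d
    ...   | yes _ = s≤s (+-mono-≤ (+-mono-≤ a≤m weighted-≤) total-≤)
    ...   | no _  = s≤s (≤-trans (+-mono-≤ a≤m weighted-≤) (m≤m+n _ (r₂ * m)))

vectors : ℕ → ℕ → List (List ℕ)
vectors m zero    = [] ∷ []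
vectors m (suc d) = cartesianProductWith _∷_ (upTo m) (vectors m d)

length-vectors : ∀ m d → length (vectors m d) ≡ m ^ d
length-vectors m zero    = refl
length-vectors m (suc d) = trans (length-cartesianProductWith _∷_ (upTo m) (vectors m d))
                                 (cong₂ _*_ (length-upTo m) (length-vectors m d))

vectors-unique : ∀ m d → Unique (vectors m d)
vectors-unique m zero    = [] ∷ []
vectors-unique m (suc d) = cartesianProductWith⁺ _∷_ ∷-injective (upTo⁺ m) (vectors-unique m d)

∈-vectors⁻ : ∀ m d {v} → v ∈ vectors m d → length v ≡ d × (∀ p → p < d → nth v p < m)
∈-vectors⁻ m zero    (here refl) = refl , λ p ()
∈-vectors⁻ m (suc d) v∈ with ∈-cartesianProductWith⁻ _∷_ (upTo m) (vectors m d) v∈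
... | x , w , x∈ , w∈ , refl with ∈-vectors⁻ m d w∈
...   | length-w , w<m = cong suc length-w , bounded
  where
  bounded : ∀ p → p < suc d → nth (x ∷ w) p < m
  bounded zero    _         = ∈-upTo⁻ x∈
  bounded (suc p) (s≤s p<d) = w<m p p<d

nth-extensionality : ∀ v w → length v ≡ length w → (∀ p → p < length v → nth v p ≡ nth w p) → v ≡ w
nth-extensionality []      []      _        _     = refl
nth-extensionality (x ∷ v) (y ∷ w) length≡ nth≡ =
  cong₂ _∷_ (nth≡ 0 (s≤s z≤n)) (nth-extensionality v w (suc-injective length≡) λ p p< → nth≡ (suc p) (s≤s p<))

module Construction (r₃ : ℕ)
  (m sh : ℕ) (B : List ℕ) (B-unique : Unique B) (B-window : ∀ {a} → a ∈ B → sh < a × a ≤ sh + m)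
  (n : ℕ) (kP≤n : Tuples.k (suc r₃) * Tuples.labels (suc r₃) m ≤ n) (K : ℕ) (K≡k : K ≡ Tuples.k (suc r₃))
  where

  open Tuples (suc r₃)
  open Transversal n (labels m) k kP≤n

  r : ℕ
  r = 3 + r₃

  parameters : List (List ℕ × ℕ)
  parameters = cartesianProduct (vectors m d) B

  tupleOf : List ℕ × ℕ → ℕ → ℕ
  tupleOf (v , a) = tuple v (a ∸ sh)

  edgeOf : List ℕ × ℕ → Subset n
  edgeOf x = transversal (tupleOf x)

  tupleOf-bounded : ∀ {x} → x ∈ parameters → Bounded (tupleOf x)
  tupleOf-bounded {v , a} x∈ with ∈-cartesianProduct⁻ (vectors m d) B x∈
  ... | v∈ , a∈B = tuple-bounded (proj₂ (∈-vectors⁻ m d v∈))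
                     (≤-trans (∸-monoˡ-≤ sh (proj₂ (B-window a∈B))) (≤-reflexive (m+n∸m≡n sh m)))

  ∸sh-injective : ∀ {a b} → a ∈ B → b ∈ B → a ∸ sh ≡ b ∸ sh → a ≡ b
  ∸sh-injective {a} {b} a∈B b∈B a∸sh≡b∸sh = begin
    a           ≡⟨ m∸n+n≡m (<⇒≤ (proj₁ (B-window a∈B))) ⟨
    a ∸ sh + sh ≡⟨ cong (_+ sh) a∸sh≡b∸sh ⟩
    b ∸ sh + sh ≡⟨ m∸n+n≡m (<⇒≤ (proj₁ (B-window b∈B))) ⟩
    b           ∎
    where open ≡-Reasoning

  edgeOf-injective : ∀ {x y} → x ∈ parameters → y ∈ parameters → edgeOf x ≡ edgeOf y → x ≡ y
  edgeOf-injective {v , a} {w , b} x∈ y∈ edge≡ = cong₂ _,_ v≡w (∸sh-injective a∈B b∈B a∸sh≡b∸sh)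
    where
    open ≡-Reasoning
    a∈B : a ∈ B
    a∈B = proj₂ (∈-cartesianProduct⁻ (vectors m d) B x∈)
    b∈B : b ∈ B
    b∈B = proj₂ (∈-cartesianProduct⁻ (vectors m d) B y∈)
    length-v : length v ≡ d
    length-v = proj₁ (∈-vectors⁻ m d (proj₁ (∈-cartesianProduct⁻ (vectors m d) B x∈)))
    length-w : length w ≡ d
    length-w = proj₁ (∈-vectors⁻ m d (proj₁ (∈-cartesianProduct⁻ (vectors m d) B y∈)))
    same : ∀ p → p < k → tuple v (a ∸ sh) p ≡ tuple w (b ∸ sh) p
    same = transversal-injective (tupleOf-bounded x∈) edge≡
    v≡w : v ≡ w
    v≡w = nth-extensionality v w (trans length-v (sym length-w)) λ p p<length-v →
      let p<d = subst (p <_) length-v p<length-v in begin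
      nth v p              ≡⟨ tuple-< v (a ∸ sh) p<d ⟨
      tuple v (a ∸ sh) p   ≡⟨ same p (<-trans p<d (<-trans (n<1+n d) (n<1+n (suc d)))) ⟩
      tuple w (b ∸ sh) p   ≡⟨ tuple-< w (b ∸ sh) p<d ⟩
      nth w p              ∎
    a∸sh≡b∸sh : a ∸ sh ≡ b ∸ sh
    a∸sh≡b∸sh = +-cancelʳ-≡ (weighted v) _ _ (begin
      a ∸ sh + weighted v        ≡⟨ tuple-1+d v (a ∸ sh) ⟨
      tuple v (a ∸ sh) (suc d)   ≡⟨ same (suc d) ≤-refl ⟩
      tuple w (b ∸ sh) (suc d)   ≡⟨ tuple-1+d w (b ∸ sh) ⟩
      b ∸ sh + weighted w        ≡⟨ cong (λ u → b ∸ sh + weighted u) v≡w ⟨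
      b ∸ sh + weighted v        ∎)

  H : KGraph K n
  H = record
    { edges   = map edgeOf parameters
    ; unique  = unique-map⁺ edgeOf edgeOf-injective (cartesianProduct⁺ (vectors-unique m d) B-unique)
    ; uniform = All.tabulate λ e∈ → let x , x∈ , e≡ = ∈-map⁻ edgeOf e∈ in
        trans (cong ∣_∣ e≡) (trans (∣transversal∣ (tupleOf-bounded x∈)) (sym K≡k))
    }

  ∣E∣-H : ∣E∣ H ≡ m ^ d * length B
  ∣E∣-H = trans (length-map edgeOf parameters)
                (trans (length-cartesianProductWith _,_ (vectors m d) B) (cong (_* length B) (length-vectors m d)))

  k≡s+1+s : k ≡ s + suc s
  k≡s+1+s = sym (trans (+-suc s (suc (suc r₃))) (cong suc (+-suc s (suc r₃))))

  H-Q-free : ¬ HasAP r B → ¬ Contains H (Q K r)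
  H-Q-free B-AP-free (φ , φ-injective , edges∈H) =
    B-AP-free (affine⇒HasAP B r (C ℤ.+ + sh) T (slope≢0 qt k≤ balanced) (s≤s z≤n) progression)
    where
    edge : Fin r → List (QEdges.Vertex (K ∸ r) r)
    edge = QEdges.edge (K ∸ r) r
    chosen : ∀ i → ∃[ x ] (x ∈ parameters × image φ (edge i) ≡ edgeOf x)
    chosen i = ∈-map⁻ edgeOf (All.lookup (All.map⁻ edges∈H) (∈-allFin i))
    x : Fin r → List ℕ × ℕ
    x i = proj₁ (chosen i)
    x∈ : ∀ i → x i ∈ parameters
    x∈ i = proj₁ (proj₂ (chosen i))
    qt : QTuples k r
    qt = CopyInTransversal.qTuples n (labels m) k kP≤n (K ∸ r) r₃ φ φ-injective
           (tupleOf ∘ x) (tupleOf-bounded ∘ x∈) (proj₂ ∘ proj₂ ∘ chosen)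
    k≤ : k ≤ s + suc s
    k≤ = ≤-reflexive k≡s+1+s
    balanced : ∀ i → dot k weight (tupleOf (x i)) ≡ 0ℤ
    balanced i = tuple-balanced (proj₁ (x i)) (proj₂ (x i) ∸ sh)
    T : ℤ
    T = slope qt k≤ balanced
    C : ℤ
    C = proj₁ (moments-affine qt k≤ balanced)
    progression : ∀ y → y < r → ∃[ a ] (a ∈ B × + a ≡ (C ℤ.+ + sh) ℤ.+ T ℤ.* + y)
    progression y y<r = a , a∈B , (begin
      + a                        ≡⟨ cong +_ (m∸n+n≡m (<⇒≤ (proj₁ (B-window a∈B)))) ⟨
      + (a ∸ sh + sh)            ≡⟨ ℤ.pos-+ (a ∸ sh) sh ⟩
      + (a ∸ sh) ℤ.+ + sh        ≡⟨ cong (ℤ._+ + sh) (trans (sym (tuple-moment (proj₁ (x i)) (a ∸ sh))) moment≡) ⟩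
      (C ℤ.+ T ℤ.* + y) ℤ.+ + sh ≡⟨ solve 4 (λ C T Y S → (C :+ T :* Y) :+ S := (C :+ S) :+ T :* Y) refl C T (+ y) (+ sh) ⟩
      (C ℤ.+ + sh) ℤ.+ T ℤ.* + y ∎)
      where
      open ≡-Reasoning
      open ℤ-Solver.+-*-Solver
      i : Fin r
      i = proj₁ (proj₂ (moments-affine qt k≤ balanced) y y<r)
      moment≡ : dot k moment (tupleOf (x i)) ≡ C ℤ.+ T ℤ.* + y
      moment≡ = proj₂ (proj₂ (moments-affine qt k≤ balanced) y y<r)
      a : ℕ
      a = proj₂ (x i)
      a∈B : a ∈ B
      a∈B = proj₂ (∈-cartesianProduct⁻ (vectors m d) B (x∈ i))

block-window : ∀ m .{{_ : NonZero m}} {a} → 1 ≤ a → ((a ∸ 1) / m) * m < a × a ≤ ((a ∸ 1) / m) * m + m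
block-window m {suc a′} _ =
    s≤s (≤-trans (m≤n+m _ (a′ % m)) (≤-reflexive (sym (m≡m%n+[m/n]*n a′ m))))
  , ≤-trans (≤-reflexive (cong suc (m≡m%n+[m/n]*n a′ m)))
            (≤-trans (+-monoˡ-< (a′ / m * m) (m%n<n a′ m)) (≤-reflexive (+-comm m (a′ / m * m))))

record DenseWindow (m K : ℕ) (A : List ℕ) : Set where
  field
    shift          : ℕ
    members        : List ℕ
    members-unique : Unique members
    members-range  : ∀ {a} → a ∈ members → shift < a × a ≤ shift + m
    members⊆A      : ∀ {a} → a ∈ members → a ∈ A
    dense          : length A ≤ K * length members

dense-window : ∀ m .{{_ : NonZero m}} K n (A : List ℕ) → 0 < K → n ≤ K * m → SubsetUpTo n A → DenseWindow m K A
dense-window m K n A 0<K n≤Km (A-unique , A⊆[1,n]) = record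
  { shift          = b * m
  ; members        = fibre block b A
  ; members-unique = filter⁺ (λ x → b ≟ block x) A-unique
  ; members-range  = B-window
  ; members⊆A      = B⊆A
  ; dense          = proj₂ popular
  }
  where
  block : ℕ → ℕ
  block x = (x ∸ 1) / m
  block<K : All (λ x → block x < K) A
  block<K = All.map (λ (1≤x , x≤n) → m<n*o⇒m/o<n (≤-trans (pred<n 1≤x x≤n) n≤Km)) A⊆[1,n]
    where
    pred<n : ∀ {x} → 1 ≤ x → x ≤ n → x ∸ 1 < n
    pred<n {suc x} _ x≤n = x≤n
  popular : ∃[ b ] length A ≤ K * length (fibre block b A)
  popular = large-fibre block K A 0<K block<K
  b : ℕ
  b = proj₁ popular
  B⊆A : ∀ {a} → a ∈ fibre block b A → a ∈ A
  B⊆A a∈B = proj₁ (∈-filter⁻ (λ x → b ≟ block x) {xs = A} a∈B)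
  B-window : ∀ {a} → a ∈ fibre block b A → b * m < a × a ≤ b * m + m
  B-window a∈B = let a∈A , b≡ = ∈-filter⁻ (λ x → b ≟ block x) {xs = A} a∈B in
    subst (λ b′ → b′ * m < _ × _ ≤ b′ * m + m) (sym b≡) (block-window m (proj₁ (All.lookup A⊆[1,n] a∈A)))

^-distribʳ-* : ∀ a b d → (a * b) ^ d ≡ a ^ d * b ^ d
^-distribʳ-* a b zero    = refl
^-distribʳ-* a b (suc d) rewrite ^-distribʳ-* a b d =
  solve 4 (λ a b x y → (a :* b) :* (x :* y) := (a :* x) :* (b :* y)) refl a b (a ^ d) (b ^ d)
  where open ℕ-Solver.+-*-Solver

sandwich : ∀ N .{{_ : NonZero N}} n → N ≤ n → ∃[ m′ ] (N * suc m′ ≤ n × n ≤ (N + N) * suc m′)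
sandwich N n N≤n with n / N | m/n*n≤m n N | m≡m%n+[m/n]*n n N | m≥n⇒m/n>0 {n} {N} N≤n
... | suc m′ | q*N≤n | n≡ | _ = m′ , subst (_≤ n) (*-comm (suc m′) N) q*N≤n ,
  ≤-trans (≤-reflexive n≡) (≤-trans (+-monoˡ-≤ (suc m′ * N) (≤-trans (<⇒≤ (m%n<n n N)) (m≤m*n N (suc m′))))
    (≤-reflexive (solve 2 (λ N m → N :* m :+ m :* N := (N :+ N) :* m) refl N (suc m′))))
  where open ℕ-Solver.+-*-Solver

module Bound (r₃ : ℕ) where

  open ℕ-Solver.+-*-Solver
  open Tuples (suc r₃) using (k; d; labels)

  r K : ℕ
  r = 3 + r₃
  K = 2 * r ∸ 1

  K∸2≡d : K ∸ 2 ≡ d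
  K∸2≡d = solve 1 (λ x → x :+ (con 3 :+ (x :+ con 0)) := con 2 :+ (x :+ (con 1 :+ x))) refl r₃

  c N : ℕ
  c = suc (suc (suc r₃ * suc r₃ + suc r₃))
  N = k * c

  labels≤ : ∀ m′ → labels (suc m′) ≤ c * suc m′
  labels≤ m′ = ≤-trans (+-monoˡ-≤ (m + suc r₃ * (suc r₃ * m) + suc r₃ * m) (s≤s (z≤n {m′})))
    (≤-reflexive (solve 2 (λ t m → m :+ (m :+ t :* (t :* m) :+ t :* m) := (con 2 :+ (t :* t :+ t)) :* m) refl (suc r₃) m))
    where
    m : ℕ
    m = suc m′

  ex-≥ : ∀ n m′ e sh B → Unique B → (∀ {a} → a ∈ B → sh < a × a ≤ sh + suc m′) → ¬ HasAP r B →
         N * suc m′ ≤ n → IsEx K n (Q K r) e → suc m′ ^ d * length B ≤ e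
  ex-≥ n m′ e sh B B-unique B-window B-AP-free Nm≤n (_ , ex-max) =
    subst (_≤ e) ∣E∣-H (ex-max H (H-Q-free B-AP-free))
    where
    kP≤n : k * labels (suc m′) ≤ n
    kP≤n = ≤-trans (*-monoʳ-≤ k (labels≤ m′)) (≤-trans (≤-reflexive (sym (*-assoc k c (suc m′)))) Nm≤n)
    open Construction r₃ (suc m′) sh B B-unique B-window n kP≤n K (cong (λ z → suc (suc z)) K∸2≡d)
      using (H; ∣E∣-H; H-Q-free)

  extremal-bound : ∀ n m′ e s → N * suc m′ ≤ n → n ≤ (N + N) * suc m′ →
                   IsEx K n (Q K r) e → IsRAP r n s → s * n ^ d ≤ (N + N) ^ suc d * e
  extremal-bound n m′ e s Nm≤n n≤2Nm ex ((A , A⊆[1,n] , A-AP-free , length-A) , _) = begin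
    s * n ^ d
      ≤⟨ *-mono-≤ (subst (_≤ (N + N) * length B) length-A dense) (^-monoˡ-≤ d n≤2Nm) ⟩
    (N + N) * length B * ((N + N) * suc m′) ^ d
      ≡⟨ cong ((N + N) * length B *_) (^-distribʳ-* (N + N) (suc m′) d) ⟩
    (N + N) * length B * ((N + N) ^ d * suc m′ ^ d)
      ≡⟨ solve 4 (λ K L x y → K :* L :* (x :* y) := (K :* x) :* (y :* L)) refl (N + N) (length B) ((N + N) ^ d) (suc m′ ^ d) ⟩
    (N + N) ^ suc d * (suc m′ ^ d * length B)
      ≤⟨ *-monoʳ-≤ ((N + N) ^ suc d) (ex-≥ n m′ e shift B members-unique members-range B-AP-free Nm≤n ex) ⟩
    (N + N) ^ suc d * e ∎
    where
    open ≤-Reasoning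
    open DenseWindow (dense-window (suc m′) (N + N) n A (s≤s z≤n) n≤2Nm A⊆[1,n]) renaming (members to B)
    B-AP-free : ¬ HasAP r B
    B-AP-free = A-AP-free ∘ HasAP-mono members⊆A

mainTheorem2 : ∀ (r : ℕ) → 3 ≤ r →
    ∃[ p ] ∃[ q ] (0 < p × 0 < q × ∃[ N ] (∀ n → N ≤ n → ∀ e s →
      IsEx (2 * r ∸ 1) n (Q (2 * r ∸ 1) r) e → IsRAP r n s →
      p * s * n ^ ((2 * r ∸ 1) ∸ 2) ≤ q * e))
mainTheorem2 (suc (suc (suc r₃))) (s≤s (s≤s (s≤s _))) =
  1 , (N + N) ^ suc d , s≤s z≤n , m^n>0 (N + N) (suc d) , N , λ n N≤n e s ex rap →
    let m′ , Nm≤n , n≤2Nm = sandwich N n N≤n in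
    subst (λ x → 1 * s * n ^ x ≤ (N + N) ^ suc d * e) (sym K∸2≡d)
      (subst (_≤ (N + N) ^ suc d * e) (sym (cong (_* n ^ d) (*-identityˡ s)))
        (extremal-bound n m′ e s Nm≤n n≤2Nm ex rap))
  where
  open Bound r₃
  open Tuples (suc r₃) using (d)
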